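{- Let $N$ be a positive integer and $n\in\{0,1,\dots,N-1\}$. Then, in $\mathbb{Q}(z)[[t]]$, \[ \prod_{n<j<N}\Bigl(1+\frac{t}{j}\Bigr)\prod_{n<j\le N}\Bigl(1-\frac{t}{z-j}\Bigr)^{ -1}=\sum_{p=0}^{\infty}\zeta^{\diamondsuit}_{n,N}(\{1\}^p;z)\,t^p, \] where $\zeta^{\diamondsuit}_{n,N}(\{1\}^0;z)=1$.
   Context: $z,t$ are indeterminates, $[m]=\{1,\dots,m\}$, $\{1\}^p$ denotes the index $(1,\dots,1)$ of depth $p$. For an index $\boldsymbol{k}=(k_1,\dots,k_r)$ of positive integers, $[r]^1_{\boldsymbol{k}}=\{i\mid k_i=1\}$, and for $n\in\{0,\dots,N-1\}$, \[ \zeta^{\diamondsuit}_{n,N}(\boldsymbol{k};z)=\sum_{A\subset[r]^1_{\boldsymbol{k}}}\ \sum_{\substack{(n_1,\dots,n_{r+1})\in\{n+1,\dots,N\}^{r+1}\\ n_i\le n_{i+1}\ (i\in A),\ n_i<n_{i+1}\ (i\in[r]\setminus A)\\ n_{r+1}=N}}\ \prod_{i\in A}\frac{1}{z-n_i}\prod_{i\in[r]\setminus A}\frac{1}{n_i^{k_i}}. \] -}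

module Defs where

open import Data.Bool using (Bool; true; false; if_then_else_; _∧_)
open import Data.Nat as ℕ using (ℕ; zero; suc; _∸_; _≤ᵇ_; _<ᵇ_; _≡ᵇ_)
open import Data.List using (List; []; _∷_; map; concatMap; applyUpTo; length; foldr; replicate)
open import Data.Integer using (+_)
open import Data.Rational using (ℚ; 0ℚ; 1ℚ; _+_; _*_; _-_; 1/_; ≢-nonZero; _/_)
open import Data.Rational.Properties using (_≟_)
open import Relation.Nullary using (yes; no)

ℕ→ℚ : ℕ → ℚ
ℕ→ℚ m = (+ m) / 1

-- total reciprocal (1/q for q ≠ 0; junk value 0 at 0, never used under the hypotheses)
inv : ℚ → ℚ
inv q with q ≟ 0ℚ
... | yes _ = 0ℚ
... | no q≢0 = 1/_ q {{≢-nonZero q≢0}}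

_^ᵠ_ : ℚ → ℕ → ℚ
q ^ᵠ zero = 1ℚ
q ^ᵠ suc k = q * (q ^ᵠ k)

sumℚ : List ℚ → ℚ
sumℚ = foldr _+_ 0ℚ

-- the list [a+1, a+2, …, b]  (empty if b ≤ a)
range : ℕ → ℕ → List ℕ
range a b = applyUpTo (λ i → suc a ℕ.+ i) (b ∸ a)

tuples : ℕ → List ℕ → List (List ℕ)
tuples zero    xs = [] ∷ []
tuples (suc r) xs = concatMap (λ x → map (x ∷_) (tuples r xs)) xs

-- all subsets of [r], as characteristic lists of length r
subsets : ℕ → List (List Bool)
subsets zero    = [] ∷ []
subsets (suc r) = concatMap (λ b → map (b ∷_) (subsets r)) (true ∷ false ∷ [])

-- next value n_{i+1}, with n_{r+1} = N
nextVal : ℕ → List ℕ → ℕ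
nextVal N []      = N
nextVal N (m ∷ _) = m

-- admissibility of (A, (n_1,…,n_r)) for index k:
-- A ⊂ [r]^1_k, n_i ≤ n_{i+1} for i ∈ A, n_i < n_{i+1} for i ∉ A, n_{r+1} = N
admissible : ℕ → List ℕ → List Bool → List ℕ → Bool
admissible N []       []       []       = true
admissible N (k ∷ ks) (a ∷ as) (m ∷ ms) =
  (if a then (k ≡ᵇ 1) ∧ (m ≤ᵇ nextVal N ms) else (m <ᵇ nextVal N ms))
  ∧ admissible N ks as ms
admissible N _ _ _ = false

weight : ℚ → List ℕ → List Bool → List ℕ → ℚ
weight z (k ∷ ks) (a ∷ as) (m ∷ ms) =
  (if a then inv (z - ℕ→ℚ m) else inv (ℕ→ℚ m ^ᵠ k)) * weight z ks as ms
weight z _ _ _ = 1ℚ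

-- ζ^♢_{n,N}(k; z), evaluated at a rational z
ζ♢ : ℕ → ℕ → List ℕ → ℚ → ℚ
ζ♢ n N k z =
  sumℚ (concatMap (λ A → map (λ ns → if admissible N k A ns then weight z k A ns else 0ℚ)
                             (tuples (length k) (range n N)))
                  (subsets (length k)))

Series : Set
Series = ℕ → ℚ

_⊛_ : Series → Series → Series
(f ⊛ g) p = sumℚ (applyUpTo (λ i → f i * g (p ∸ i)) (suc p))

oneS : Series
oneS zero    = 1ℚ
oneS (suc _) = 0ℚ

prodS : List Series → Series
prodS = foldr _⊛_ oneS

linS : ℕ → Series
linS j zero          = 1ℚ
linS j (suc zero)    = inv (ℕ→ℚ j)
linS j (suc (suc _)) = 0ℚ

-- (1 - t/(z-j))^{-1} = Σ_k t^k/(z-j)^k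
geomS : ℚ → ℕ → Series
geomS z j k = inv (z - ℕ→ℚ j) ^ᵠ k

lhsS : ℕ → ℕ → ℚ → Series
lhsS n N z = prodS (map linS (range n (N ∸ 1))) ⊛ prodS (map (geomS z) (range n N))

rhsS : ℕ → ℕ → ℚ → Series
rhsS n N z p = ζ♢ n N (replicate p 1) z

{-# OPTIONS --safe #-}
-- Let C_p(c) be the part of ζ♢_{n,N}({1}^p; z) coming from chains with n₁ ≥ c (for p = 0 the
-- empty chain, counted iff c ≤ N).  Splitting off the smallest entry n₁ = c, which carries
-- weight 1/(z − c) and allows n₂ ≥ c if 1 ∈ A, and weight 1/c with n₂ > c otherwise, gives,
-- for n < c ≤ N,
--   C_{p+1}(c) = C_{p+1}(c + 1) + C_p(c)/(z − c) + C_p(c + 1)/c ,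
-- i.e. G_c = (1 − t/(z − c))⁻¹ (1 + t/c) G_{c+1} for the generating series G_c = Σ_p C_p(c) t^p,
-- while G_N = (1 − t/(z − N))⁻¹ because C_p(N + 1) = 0.  Telescoping from c = n + 1 yields the
-- product, and G_{n+1} is the right-hand side since every entry of a chain exceeds n anyway.
module Submission where

open import Defs
open import Algebra.Bundles using (CommutativeSemigroup)
open import Data.Bool using (Bool; true; false; if_then_else_; _∧_)
open import Data.Bool.Properties using (T-≡)
open import Data.Empty using (⊥-elim)
open import Data.List using (List; []; _∷_; _++_; map; concatMap; applyUpTo; replicate)
open import Data.List.Properties using (map-∘; map-cong; map-concatMap; length-replicate)
open import Data.Nat as ℕ using (ℕ; zero; suc; _≤_; _<_; _≤ᵇ_; _∸_; z≤n; s≤s)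
open import Data.Nat.Properties
  using (≤⇒≤ᵇ; ≤ᵇ⇒≤; <⇒≱; <⇒≤; ≤-refl; ≤-trans; ≤-reflexive; n≤1+n; n<1+n; m≤n⇒m≤1+n; m<n⇒m<1+n;
         m≤n⇒m<n∨m≡n; m≤m+n; m≤n+m; +-suc; m+[n∸m]≡n; m∸n+n≡m; +-∸-assoc)
  renaming (+-identityʳ to ℕ-+-identityʳ)
open import Data.Rational using (ℚ; 0ℚ; 1ℚ; _+_; _-_; _*_)
open import Data.Rational.Properties
  using (+-identityˡ; +-identityʳ; +-assoc; *-comm; *-identityˡ; *-identityʳ; *-zeroˡ; *-zeroʳ; *-distribˡ-+)
open import Data.Rational.Solver using (module +-*-Solver)
open import Data.Sum using (inj₁; inj₂)
open import Function using (Equivalence; _∘_)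
open import Level using (0ℓ)
open import Relation.Binary.PropositionalEquality
import Relation.Binary.Reasoning.Setoid
open import Relation.Nullary using (contradiction)
open +-*-Solver using (solve; _:+_; _:*_; _:=_; con)

infixl 7 _·ₛ_
infixl 6 _+ₛ_

shift : Series → Series
shift f i = f (suc i)

_·ₛ_ : ℚ → Series → Series
(c ·ₛ f) i = c * f i

_+ₛ_ : Series → Series → Series
(f +ₛ g) i = f i + g i

0ₛ : Series
0ₛ _ = 0ℚ

⊛-cong : ∀ {f f′ g g′} → f ≗ f′ → g ≗ g′ → f ⊛ g ≗ f′ ⊛ g′
⊛-cong f≗f′ g≗g′ zero    = cong (_+ 0ℚ) (cong₂ _*_ (f≗f′ 0) (g≗g′ 0))
⊛-cong {f} {f′} f≗f′ g≗g′ (suc p) =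
  cong₂ _+_ (cong₂ _*_ (f≗f′ 0) (g≗g′ (suc p))) (⊛-cong {shift f} {shift f′} (f≗f′ ∘ suc) g≗g′ p)

⊛-zeroˡ : ∀ g → 0ₛ ⊛ g ≗ 0ₛ
⊛-zeroˡ g zero    = trans (+-identityʳ _) (*-zeroˡ (g 0))
⊛-zeroˡ g (suc p) = trans (cong₂ _+_ (*-zeroˡ (g (suc p))) (⊛-zeroˡ g p)) (+-identityʳ 0ℚ)

⊛-identityˡ : ∀ g → oneS ⊛ g ≗ g
⊛-identityˡ g zero    = trans (+-identityʳ _) (*-identityˡ (g 0))
⊛-identityˡ g (suc p) = trans (cong₂ _+_ (*-identityˡ (g (suc p))) (⊛-zeroˡ g p)) (+-identityʳ _)

⊛-scaleˡ : ∀ c f g → (c ·ₛ f) ⊛ g ≗ c ·ₛ (f ⊛ g)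
⊛-scaleˡ c f g zero =
  solve 3 (λ c a b → c :* a :* b :+ con 0ℚ := c :* (a :* b :+ con 0ℚ)) refl c (f 0) (g 0)
⊛-scaleˡ c f g (suc p) = trans (cong (c * f 0 * g (suc p) +_) (⊛-scaleˡ c (shift f) g p))
  (solve 4 (λ c a b d → c :* a :* b :+ c :* d := c :* (a :* b :+ d)) refl c (f 0) (g (suc p)) _)

⊛-distribʳ : ∀ f f′ g → (f +ₛ f′) ⊛ g ≗ (f ⊛ g) +ₛ (f′ ⊛ g)
⊛-distribʳ f f′ g zero =
  solve 3 (λ a a′ b → (a :+ a′) :* b :+ con 0ℚ := (a :* b :+ con 0ℚ) :+ (a′ :* b :+ con 0ℚ))
    refl (f 0) (f′ 0) (g 0)
⊛-distribʳ f f′ g (suc p) =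
  trans (cong ((f 0 + f′ 0) * g (suc p) +_) (⊛-distribʳ (shift f) (shift f′) g p))
    (solve 5 (λ a a′ b x y → (a :+ a′) :* b :+ (x :+ y) := (a :* b :+ x) :+ (a′ :* b :+ y))
      refl (f 0) (f′ 0) (g (suc p)) _ _)

-- shift (f ⊛ g) is definitionally (f 0 ·ₛ shift g) +ₛ (shift f ⊛ g).
⊛-assoc : ∀ f g h → (f ⊛ g) ⊛ h ≗ f ⊛ (g ⊛ h)
⊛-assoc f g h zero =
  solve 3 (λ a b c → (a :* b :+ con 0ℚ) :* c :+ con 0ℚ := a :* (b :* c :+ con 0ℚ) :+ con 0ℚ)
    refl (f 0) (g 0) (h 0)
⊛-assoc f g h (suc p) = begin
  fg₀ * h (suc p) + (shift (f ⊛ g) ⊛ h) p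
    ≡⟨ cong (fg₀ * h (suc p) +_) (⊛-distribʳ (f 0 ·ₛ shift g) (shift f ⊛ g) h p) ⟩
  fg₀ * h (suc p) + (((f 0 ·ₛ shift g) ⊛ h) p + ((shift f ⊛ g) ⊛ h) p)
    ≡⟨ cong (fg₀ * h (suc p) +_) (cong₂ _+_ (⊛-scaleˡ (f 0) (shift g) h p) (⊛-assoc (shift f) g h p)) ⟩
  fg₀ * h (suc p) + (f 0 * (shift g ⊛ h) p + (shift f ⊛ (g ⊛ h)) p)
    ≡⟨ solve 5 (λ a b c x y → (a :* b :+ con 0ℚ) :* c :+ (a :* x :+ y) := a :* (b :* c :+ x) :+ y)
         refl (f 0) (g 0) (h (suc p)) _ _ ⟩
  f 0 * (g 0 * h (suc p) + (shift g ⊛ h) p) + (shift f ⊛ (g ⊛ h)) p ∎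
  where
  open ≡-Reasoning
  fg₀ = (f ⊛ g) 0

⊛-sucʳ : ∀ f g p → (f ⊛ g) (suc p) ≡ (f ⊛ shift g) p + f (suc p) * g 0
⊛-sucʳ f g zero =
  solve 4 (λ a b c d → a :* b :+ (c :* d :+ con 0ℚ) := (a :* b :+ con 0ℚ) :+ c :* d)
    refl (f 0) (g 1) (f 1) (g 0)
⊛-sucʳ f g (suc p) =
  trans (cong (f 0 * g (suc (suc p)) +_) (⊛-sucʳ (shift f) g p)) (sym (+-assoc (f 0 * g (suc (suc p))) ((shift f ⊛ shift g) p) (f (suc (suc p)) * g 0)))

⊛-comm : ∀ f g → f ⊛ g ≗ g ⊛ f
⊛-comm f g zero    = cong (_+ 0ℚ) (*-comm (f 0) (g 0))
⊛-comm f g (suc p) = begin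
  f 0 * g (suc p) + (shift f ⊛ g) p ≡⟨ cong (f 0 * g (suc p) +_) (⊛-comm (shift f) g p) ⟩
  f 0 * g (suc p) + (g ⊛ shift f) p ≡⟨ solve 3 (λ a b x → a :* b :+ x := x :+ b :* a) refl (f 0) (g (suc p)) _ ⟩
  (g ⊛ shift f) p + g (suc p) * f 0 ≡⟨ ⊛-sucʳ g f p ⟨
  (g ⊛ f) (suc p)                   ∎
  where open ≡-Reasoning

⊛-commutativeSemigroup : CommutativeSemigroup 0ℓ 0ℓ
⊛-commutativeSemigroup = record
  { Carrier = Series
  ; _≈_     = _≗_
  ; _∙_     = _⊛_
  ; isCommutativeSemigroup = record
    { isSemigroup = record
      { isMagma = record
        { isEquivalence = record
          { refl  = λ _ → refl
          ; sym   = λ f≗g i → sym (f≗g i)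
          ; trans = λ f≗g g≗h i → trans (f≗g i) (g≗h i)
          }
        ; ∙-cong = ⊛-cong
        }
      ; assoc = ⊛-assoc
      }
    ; comm = ⊛-comm
    }
  }

open import Algebra.Properties.CommutativeSemigroup ⊛-commutativeSemigroup using (interchange; x∙yz≈yx∙z)
module ≗-Reasoning = Relation.Binary.Reasoning.Setoid (CommutativeSemigroup.setoid ⊛-commutativeSemigroup)

-- The coefficientwise form of (1 − u t) H = K, whose solution is H = (1 − u t)⁻¹ K.
recurrence⇒≗powers⊛ : ∀ u H K → H 0 ≡ K 0 → (∀ p → H (suc p) ≡ u * H p + K (suc p)) →
  H ≗ (u ^ᵠ_) ⊛ K
recurrence⇒≗powers⊛ u H K H₀≡K₀ H-suc zero = trans H₀≡K₀ (sym (trans (+-identityʳ _) (*-identityˡ _)))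
recurrence⇒≗powers⊛ u H K H₀≡K₀ H-suc (suc p) = begin
  H (suc p)                               ≡⟨ H-suc p ⟩
  u * H p + K (suc p)                     ≡⟨ cong (λ h → u * h + K (suc p)) (recurrence⇒≗powers⊛ u H K H₀≡K₀ H-suc p) ⟩
  u * ((u ^ᵠ_) ⊛ K) p + K (suc p)         ≡⟨ cong (_+ K (suc p)) (⊛-scaleˡ u (u ^ᵠ_) K p) ⟨
  ((u ·ₛ (u ^ᵠ_)) ⊛ K) p + K (suc p)      ≡⟨ solve 2 (λ x k → x :+ k := con 1ℚ :* k :+ x) refl _ (K (suc p)) ⟩
  ((u ^ᵠ_) ⊛ K) (suc p)                   ∎
  where open ≡-Reasoning

linS-⊛-suc : ∀ j f p → (linS j ⊛ f) (suc p) ≡ f (suc p) + inv (ℕ→ℚ j) * f p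
linS-⊛-suc j f p = cong₂ _+_ (*-identityˡ (f (suc p))) (tail p)
  where
  tail : ∀ p → (shift (linS j) ⊛ f) p ≡ inv (ℕ→ℚ j) * f p
  tail zero    = +-identityʳ _
  tail (suc p) = trans (cong (inv (ℕ→ℚ j) * f (suc p) +_) (⊛-zeroˡ f p)) (+-identityʳ _)

∑ : {A : Set} → List A → (A → ℚ) → ℚ
∑ xs f = sumℚ (map f xs)

infix 5 ∑
syntax ∑ xs (λ x → e) = ∑[ x ∈ xs ] e

sum-++ : ∀ xs ys → sumℚ (xs ++ ys) ≡ sumℚ xs + sumℚ ys
sum-++ []       ys = sym (+-identityˡ _)
sum-++ (x ∷ xs) ys = trans (cong (x +_) (sum-++ xs ys)) (sym (+-assoc x _ _))

sum-concatMap : {A : Set} (xs : List A) (g : A → List ℚ) → sumℚ (concatMap g xs) ≡ ∑[ x ∈ xs ] sumℚ (g x)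
sum-concatMap []       g = refl
sum-concatMap (x ∷ xs) g = trans (sum-++ (g x) (concatMap g xs)) (cong (sumℚ (g x) +_) (sum-concatMap xs g))

∑-cong : {A : Set} (xs : List A) {f g : A → ℚ} → (∀ x → f x ≡ g x) → ∑ xs f ≡ ∑ xs g
∑-cong xs f≗g = cong sumℚ (map-cong f≗g xs)

∑-map : {A B : Set} (xs : List A) (g : A → B) (f : B → ℚ) → ∑ (map g xs) f ≡ ∑[ x ∈ xs ] f (g x)
∑-map xs g f = cong sumℚ (sym (map-∘ xs))

∑-concatMap : {A B : Set} (xs : List A) (g : A → List B) (f : B → ℚ) →
  ∑ (concatMap g xs) f ≡ ∑[ x ∈ xs ] ∑ (g x) f
∑-concatMap xs g f = trans (cong sumℚ (map-concatMap f g xs)) (sum-concatMap xs (map f ∘ g))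

∑-cons-product : {A : Set} (xs : List A) (yss : List (List A)) (f : List A → ℚ) →
  ∑ (concatMap (λ x → map (x ∷_) yss) xs) f ≡ ∑[ x ∈ xs ] ∑[ ys ∈ yss ] f (x ∷ ys)
∑-cons-product xs yss f = trans (∑-concatMap xs _ f) (∑-cong xs (λ x → ∑-map yss (x ∷_) f))

∑-zero : {A : Set} (xs : List A) → ∑[ x ∈ xs ] 0ℚ ≡ 0ℚ
∑-zero []       = refl
∑-zero (x ∷ xs) = trans (+-identityˡ _) (∑-zero xs)

∑-distrib-+ : {A : Set} (xs : List A) (f g : A → ℚ) → ∑[ x ∈ xs ] (f x + g x) ≡ ∑ xs f + ∑ xs g
∑-distrib-+ []       f g = sym (+-identityʳ 0ℚ)
∑-distrib-+ (x ∷ xs) f g = trans (cong (f x + g x +_) (∑-distrib-+ xs f g))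
  (solve 4 (λ a b c d → (a :+ b) :+ (c :+ d) := (a :+ c) :+ (b :+ d)) refl (f x) (g x) _ _)

∑-comm : {A B : Set} (xs : List A) (ys : List B) (f : A → B → ℚ) →
  ∑[ x ∈ xs ] ∑[ y ∈ ys ] f x y ≡ ∑[ y ∈ ys ] ∑[ x ∈ xs ] f x y
∑-comm []       ys f = sym (∑-zero ys)
∑-comm (x ∷ xs) ys f =
  trans (cong (∑ ys (f x) +_) (∑-comm xs ys f)) (sym (∑-distrib-+ ys (f x) (λ y → ∑[ x ∈ xs ] f x y)))

*-distribˡ-∑ : {A : Set} (w : ℚ) (xs : List A) (f : A → ℚ) → ∑[ x ∈ xs ] w * f x ≡ w * ∑ xs f
*-distribˡ-∑ w []       f = sym (*-zeroʳ w)
*-distribˡ-∑ w (x ∷ xs) f = trans (cong (w * f x +_) (*-distribˡ-∑ w xs f)) (sym (*-distribˡ-+ w (f x) _))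

∑-if : {A : Set} (xs : List A) (b : Bool) (f : A → ℚ) →
  ∑[ x ∈ xs ] (if b then f x else 0ℚ) ≡ (if b then ∑ xs f else 0ℚ)
∑-if xs true  f = refl
∑-if xs false f = ∑-zero xs

∑-if-* : {A : Set} (xs : List A) (b : Bool) (w : ℚ) (f : A → ℚ) →
  ∑[ x ∈ xs ] (if b then w * f x else 0ℚ) ≡ (if b then w * ∑ xs f else 0ℚ)
∑-if-* xs true  w f = *-distribˡ-∑ w xs f
∑-if-* xs false w f = ∑-zero xs

interval : ℕ → ℕ → List ℕ
interval c zero    = []
interval c (suc k) = c ∷ interval (suc c) k

applyUpTo≡interval : ∀ (f : ℕ → ℕ) c k → (∀ i → f i ≡ c ℕ.+ i) → applyUpTo f k ≡ interval c k
applyUpTo≡interval f c zero    f≗c+ = refl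
applyUpTo≡interval f c (suc k) f≗c+ = cong₂ _∷_ (trans (f≗c+ 0) (ℕ-+-identityʳ c))
  (applyUpTo≡interval (f ∘ suc) (suc c) k (λ i → trans (f≗c+ (suc i)) (+-suc c i)))

range≡interval : ∀ a b → range a b ≡ interval (suc a) (b ∸ a)
range≡interval a b = applyUpTo≡interval _ (suc a) (b ∸ a) (λ _ → refl)

≤ᵇ-true : ∀ {m n} → m ≤ n → (m ≤ᵇ n) ≡ true
≤ᵇ-true m≤n = Equivalence.to T-≡ (≤⇒≤ᵇ m≤n)

≤ᵇ-false : ∀ {m n} → n < m → (m ≤ᵇ n) ≡ false
≤ᵇ-false {m} {n} n<m with m ≤ᵇ n in eq
... | false = refl
... | true  = contradiction (≤ᵇ⇒≤ m n (Equivalence.from T-≡ eq)) (<⇒≱ n<m)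

∑≥ : ℕ → List ℕ → (ℕ → ℚ) → ℚ
∑≥ m xs f = ∑[ x ∈ xs ] (if m ≤ᵇ x then f x else 0ℚ)

∑≥-all : ∀ {m c} k f → m ≤ c → ∑≥ m (interval c k) f ≡ ∑ (interval c k) f
∑≥-all zero    f m≤c = refl
∑≥-all {m} {c} (suc k) f m≤c rewrite ≤ᵇ-true m≤c = cong (f c +_) (∑≥-all k f (m≤n⇒m≤1+n m≤c))

∑≥-none : ∀ {m c} k f → c ℕ.+ k ≤ m → ∑≥ m (interval c k) f ≡ 0ℚ
∑≥-none zero    f _ = refl
∑≥-none {m} {c} (suc k) f c+k≤m with subst (_≤ m) (+-suc c k) c+k≤m
... | c+1+k≤m rewrite ≤ᵇ-false (≤-trans (s≤s (m≤m+n c k)) c+1+k≤m) =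
  trans (+-identityˡ _) (∑≥-none k f c+1+k≤m)

∑≥-peel : ∀ {m c} k f → c ≤ m → m < c ℕ.+ k → ∑≥ m (interval c k) f ≡ f m + ∑≥ (suc m) (interval c k) f
∑≥-peel {m} {c} zero f c≤m m<c+0 = ⊥-elim (<⇒≱ m<c+0 (≤-trans (≤-reflexive (ℕ-+-identityʳ c)) c≤m))
∑≥-peel {m} {c} (suc k) f c≤m m<c+1+k with m≤n⇒m<n∨m≡n c≤m
... | inj₂ refl rewrite ≤ᵇ-true (≤-refl {c}) | ≤ᵇ-false (n<1+n c) =
  cong (f c +_) (trans (∑≥-all k f (n≤1+n c)) (sym (trans (+-identityˡ _) (∑≥-all k f ≤-refl))))
... | inj₁ c<m rewrite ≤ᵇ-false c<m | ≤ᵇ-false (m<n⇒m<1+n c<m) =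
  trans (+-identityˡ _)
    (trans (∑≥-peel k f c<m (subst (m <_) (+-suc c k) m<c+1+k)) (cong (f m +_) (sym (+-identityˡ _))))

if-∧-* : ∀ b c (w t : ℚ) → (if b ∧ c then w * t else 0ℚ) ≡ (if b then w * (if c then t else 0ℚ) else 0ℚ)
if-∧-* true  true  w t = refl
if-∧-* true  false w t = sym (*-zeroʳ w)
if-∧-* false c     w t = refl

-- chainSum p m is ζ♢_{n,N}({1}^p; z) with the chain entries drawn from R and n₁ ≥ m,
-- where n₁ means N for the empty chain.
module Chains (z : ℚ) (N : ℕ) (R : List ℕ) where

  chainTerm : ℕ → (p : ℕ) → List Bool → List ℕ → ℚ
  chainTerm m p A ns =
    if (m ≤ᵇ nextVal N ns) ∧ admissible N (replicate p 1) A ns then weight z (replicate p 1) A ns else 0ℚ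

  chainSum : ℕ → ℕ → ℚ
  chainSum p m = ∑[ A ∈ subsets p ] ∑[ ns ∈ tuples p R ] chainTerm m p A ns

  edgeWeight : Bool → ℕ → ℚ
  edgeWeight true  x = inv (z - ℕ→ℚ x)
  edgeWeight false x = inv (ℕ→ℚ x ^ᵠ 1)

  nextBound : Bool → ℕ → ℕ
  nextBound true  x = x
  nextBound false x = suc x

  chainStep : ℕ → ℕ → ℚ
  chainStep p x = ∑[ a ∈ true ∷ false ∷ [] ] edgeWeight a x * chainSum p (nextBound a x)

  chainTerm-∷ : ∀ m p a as x xs → chainTerm m (suc p) (a ∷ as) (x ∷ xs) ≡
    (if m ≤ᵇ x then edgeWeight a x * chainTerm (nextBound a x) p as xs else 0ℚ)
  chainTerm-∷ m p true  as x xs = if-∧-* (m ≤ᵇ x) _ (edgeWeight true x) (weight z (replicate p 1) as xs)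
  chainTerm-∷ m p false as x xs = if-∧-* (m ≤ᵇ x) _ (edgeWeight false x) (weight z (replicate p 1) as xs)

  chainSum-zero : ∀ m → chainSum 0 m ≡ (if m ≤ᵇ N then 1ℚ else 0ℚ)
  chainSum-zero m with m ≤ᵇ N
  ... | true  = refl
  ... | false = refl

  chainSum-suc : ∀ p m → chainSum (suc p) m ≡ ∑≥ m R (chainStep p)
  chainSum-suc p m = begin
    chainSum (suc p) m
      ≡⟨ ∑-cons-product bools (subsets p) (λ A → ∑[ ns ∈ tuples (suc p) R ] chainTerm m (suc p) A ns) ⟩
    ∑[ a ∈ bools ] ∑[ as ∈ subsets p ] ∑[ ns ∈ tuples (suc p) R ] chainTerm m (suc p) (a ∷ as) ns
      ≡⟨ ∑-cong bools (λ a → ∑-cong (subsets p) (λ as → ∑-cons-product R (tuples p R) (chainTerm m (suc p) (a ∷ as)))) ⟩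
    ∑[ a ∈ bools ] ∑[ as ∈ subsets p ] ∑[ x ∈ R ] ∑[ xs ∈ tuples p R ] term a as x xs
      ≡⟨ ∑-cong bools (λ a → ∑-comm (subsets p) R (λ as x → ∑[ xs ∈ tuples p R ] term a as x xs)) ⟩
    ∑[ a ∈ bools ] ∑[ x ∈ R ] ∑[ as ∈ subsets p ] ∑[ xs ∈ tuples p R ] term a as x xs
      ≡⟨ ∑-comm bools R (λ a x → ∑[ as ∈ subsets p ] ∑[ xs ∈ tuples p R ] term a as x xs) ⟩
    ∑[ x ∈ R ] ∑[ a ∈ bools ] ∑[ as ∈ subsets p ] ∑[ xs ∈ tuples p R ] term a as x xs
      ≡⟨ ∑-cong R (λ x → trans (∑-cong bools (λ a → branch a x))
                               (∑-if bools (m ≤ᵇ x) (λ a → edgeWeight a x * chainSum p (nextBound a x)))) ⟩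
    ∑≥ m R (chainStep p) ∎
    where
    open ≡-Reasoning
    bools = true ∷ false ∷ []
    term : Bool → List Bool → ℕ → List ℕ → ℚ
    term a as x xs = chainTerm m (suc p) (a ∷ as) (x ∷ xs)
    branch : ∀ a x → ∑[ as ∈ subsets p ] ∑[ xs ∈ tuples p R ] term a as x xs ≡
      (if m ≤ᵇ x then edgeWeight a x * chainSum p (nextBound a x) else 0ℚ)
    branch a x = begin
      ∑[ as ∈ subsets p ] ∑[ xs ∈ tuples p R ] term a as x xs
        ≡⟨ ∑-cong (subsets p) (λ as → trans (∑-cong (tuples p R) (chainTerm-∷ m p a as x))
                                            (∑-if-* (tuples p R) (m ≤ᵇ x) (edgeWeight a x) (chainTerm (nextBound a x) p as))) ⟩
      ∑[ as ∈ subsets p ] (if m ≤ᵇ x then edgeWeight a x * next as else 0ℚ)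
        ≡⟨ ∑-if-* (subsets p) (m ≤ᵇ x) (edgeWeight a x) next ⟩
      (if m ≤ᵇ x then edgeWeight a x * chainSum p (nextBound a x) else 0ℚ) ∎
      where
      next : List Bool → ℚ
      next as = ∑[ xs ∈ tuples p R ] chainTerm (nextBound a x) p as xs

ζ♢≡chainSum : ∀ z n N p → ζ♢ n N (replicate p 1) z ≡ Chains.chainSum z N (range n N) p 0
ζ♢≡chainSum z n N p rewrite length-replicate p {1} = sum-concatMap (subsets p) _

module Telescope (z : ℚ) (N n : ℕ) where

  open Chains z N (interval (suc n) (N ∸ n)) public

  G : ℕ → Series
  G c p = chainSum p c

  interval-end : n ≤ N → suc n ℕ.+ (N ∸ n) ≡ suc N
  interval-end n≤N = cong suc (m+[n∸m]≡n n≤N)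

  chainSum-init : ∀ {c} → c ≤ N → chainSum 0 c ≡ 1ℚ
  chainSum-init {c} c≤N = trans (chainSum-zero c) (cong (if_then 1ℚ else 0ℚ) (≤ᵇ-true c≤N))

  chainSum-beyond : n ≤ N → ∀ p → chainSum p (suc N) ≡ 0ℚ
  chainSum-beyond n≤N zero    = trans (chainSum-zero (suc N)) (cong (if_then 1ℚ else 0ℚ) (≤ᵇ-false (n<1+n N)))
  chainSum-beyond n≤N (suc p) =
    trans (chainSum-suc p (suc N)) (∑≥-none (N ∸ n) (chainStep p) (≤-reflexive (interval-end n≤N)))

  chainSum-peel : ∀ {c} p → n < c → c ≤ N → chainSum (suc p) c ≡ chainStep p c + chainSum (suc p) (suc c)
  chainSum-peel {c} p n<c c≤N = begin
    chainSum (suc p) c                                 ≡⟨ chainSum-suc p c ⟩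
    ∑≥ c R (chainStep p)                               ≡⟨ ∑≥-peel (N ∸ n) (chainStep p) n<c c<end ⟩
    chainStep p c + ∑≥ (suc c) R (chainStep p)         ≡⟨ cong (chainStep p c +_) (chainSum-suc p (suc c)) ⟨
    chainStep p c + chainSum (suc p) (suc c)           ∎
    where
    open ≡-Reasoning
    R = interval (suc n) (N ∸ n)
    c<end : c < suc n ℕ.+ (N ∸ n)
    c<end = subst (c <_) (sym (interval-end (<⇒≤ (≤-trans n<c c≤N)))) (s≤s c≤N)

  chainSum-bottom : n < N → ∀ p → chainSum p 0 ≡ chainSum p (suc n)
  chainSum-bottom n<N zero    = trans (chainSum-init z≤n) (sym (chainSum-init n<N))
  chainSum-bottom n<N (suc p) =
    trans (chainSum-suc p 0) (sym (trans (chainSum-suc p (suc n)) (∑≥-all (N ∸ n) (chainStep p) ≤-refl)))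

  G-top : n < N → G N ≗ geomS z N ⊛ oneS
  G-top n<N = recurrence⇒≗powers⊛ u (G N) oneS (chainSum-init ≤-refl) step
    where
    open ≡-Reasoning
    u = edgeWeight true N
    v = edgeWeight false N
    step : ∀ p → chainSum (suc p) N ≡ u * chainSum p N + 0ℚ
    step p = begin
      chainSum (suc p) N
        ≡⟨ chainSum-peel p n<N ≤-refl ⟩
      (u * chainSum p N + (v * chainSum p (suc N) + 0ℚ)) + chainSum (suc p) (suc N)
        ≡⟨ cong₂ (λ a b → (u * chainSum p N + (v * a + 0ℚ)) + b)
             (chainSum-beyond (<⇒≤ n<N) p) (chainSum-beyond (<⇒≤ n<N) (suc p)) ⟩
      (u * chainSum p N + (v * 0ℚ + 0ℚ)) + 0ℚ
        ≡⟨ solve 3 (λ u c v → (u :* c :+ (v :* con 0ℚ :+ con 0ℚ)) :+ con 0ℚ := u :* c :+ con 0ℚ)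
             refl u (chainSum p N) v ⟩
      u * chainSum p N + 0ℚ ∎

  G-step : ∀ {c} → n < c → c < N → G c ≗ (linS c ⊛ geomS z c) ⊛ G (suc c)
  G-step {c} n<c c<N p = trans
    (recurrence⇒≗powers⊛ u (G c) (linS c ⊛ G (suc c)) init step p)
    (x∙yz≈yx∙z (geomS z c) (linS c) (G (suc c)) p)
    where
    open ≡-Reasoning
    u = edgeWeight true c
    init : chainSum 0 c ≡ 1ℚ * chainSum 0 (suc c) + 0ℚ
    init rewrite chainSum-init (<⇒≤ c<N) | chainSum-init c<N = refl
    step : ∀ p → chainSum (suc p) c ≡ u * chainSum p c + (linS c ⊛ G (suc c)) (suc p)
    step p = begin
      chainSum (suc p) c
        ≡⟨ chainSum-peel p n<c (<⇒≤ c<N) ⟩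
      (u * chainSum p c + (inv (ℕ→ℚ c * 1ℚ) * chainSum p (suc c) + 0ℚ)) + chainSum (suc p) (suc c)
        ≡⟨ cong (λ w → (u * chainSum p c + (inv w * chainSum p (suc c) + 0ℚ)) + chainSum (suc p) (suc c))
             (*-identityʳ (ℕ→ℚ c)) ⟩
      (u * chainSum p c + (inv (ℕ→ℚ c) * chainSum p (suc c) + 0ℚ)) + chainSum (suc p) (suc c)
        ≡⟨ solve 5 (λ u a w b d → (u :* a :+ (w :* b :+ con 0ℚ)) :+ d := u :* a :+ (d :+ w :* b))
             refl u (chainSum p c) (inv (ℕ→ℚ c)) (chainSum p (suc c)) (chainSum (suc p) (suc c)) ⟩
      u * chainSum p c + (chainSum (suc p) (suc c) + inv (ℕ→ℚ c) * chainSum p (suc c))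
        ≡⟨ cong (u * chainSum p c +_) (linS-⊛-suc c (G (suc c)) p) ⟨
      u * chainSum p c + (linS c ⊛ G (suc c)) (suc p) ∎

  telescope : ∀ j {c} → n < c → j ℕ.+ c ≡ N →
    prodS (map linS (interval c j)) ⊛ prodS (map (geomS z) (interval c (suc j))) ≗ G c
  telescope zero n<N refl = begin
    oneS ⊛ (geomS z N ⊛ oneS) ≈⟨ ⊛-identityˡ _ ⟩
    geomS z N ⊛ oneS          ≈⟨ G-top n<N ⟨
    G N                       ∎
    where open ≗-Reasoning
  telescope (suc j) {c} n<c j+1+c≡N = begin
    (linS c ⊛ ls) ⊛ (geomS z c ⊛ gs) ≈⟨ interchange (linS c) ls (geomS z c) gs ⟩
    (linS c ⊛ geomS z c) ⊛ (ls ⊛ gs) ≈⟨ ⊛-cong {linS c ⊛ geomS z c} {linS c ⊛ geomS z c} (λ _ → refl) (telescope j (m<n⇒m<1+n n<c) (trans (+-suc j c) j+1+c≡N)) ⟩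
    (linS c ⊛ geomS z c) ⊛ G (suc c) ≈⟨ G-step n<c (≤-trans (s≤s (m≤n+m c j)) (≤-reflexive j+1+c≡N)) ⟨
    G c                              ∎
    where
    open ≗-Reasoning
    ls = prodS (map linS (interval (suc c) j))
    gs = prodS (map (geomS z) (interval (suc c) (suc j)))

-- The hypothesis z ≠ j is not needed: inv is total, and the identity holds coefficientwise
-- even at the junk value inv 0 = 0.
lemma5p6 : (N n : ℕ) → 1 ≤ N → n < N →
    (z : ℚ) → (∀ (j : ℕ) → n < j → j ≤ N → z ≢ ℕ→ℚ j) →
    ∀ (p : ℕ) → lhsS n N z p ≡ rhsS n N z p
lemma5p6 (suc M) n _ (s≤s n≤M) z _ p = begin
  lhsS n (suc M) z p
    ≡⟨ cong₂ (λ ls gs → (prodS (map linS ls) ⊛ prodS (map (geomS z) gs)) p)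
         (range≡interval n M)
         (trans (range≡interval n (suc M)) (cong (interval (suc n)) (+-∸-assoc 1 n≤M))) ⟩
  (prodS (map linS (interval (suc n) (M ∸ n))) ⊛ prodS (map (geomS z) (interval (suc n) (suc (M ∸ n))))) p
    ≡⟨ telescope (M ∸ n) ≤-refl (trans (+-suc (M ∸ n) n) (cong suc (m∸n+n≡m n≤M))) p ⟩
  chainSum p (suc n)                                ≡⟨ chainSum-bottom (s≤s n≤M) p ⟨
  chainSum p 0                                      ≡⟨ cong (λ R → Chains.chainSum z (suc M) R p 0) (range≡interval n (suc M)) ⟨
  Chains.chainSum z (suc M) (range n (suc M)) p 0   ≡⟨ ζ♢≡chainSum z n (suc M) p ⟨
  rhsS n (suc M) z p                                ∎
  where
  open ≡-Reasoning
  open Telescope z (suc M) n
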